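{- Let $G=(V,E)$ be a connected undirected graph with $|V|=n$, let $R\subset V$ be a set of terminal vertices with $|R|\ge 4$, and let $k$ be an integer with $|R|-1\le k\le n-2$. Construct the graph $\bar G=(\bar V,\bar E)$ from $G$ by adding, for each terminal $r\in R$, $n-k$ new (fictitious) vertices $v^r_1,\dots,v^r_{n-k}$, and setting $\bar E=E\cup E^R$ with $E^R=\{(v^r_j,r): j=1,\dots,n-k,\ r\in R\}$. Let $I$ be the STSWSN-PC instance on $\bar G$ with $s=n-k+1$ time slots and weights $w^1_e=0$ if $e\in E^R$ and $w^1_e=1$ otherwise, and for $j=2,\dots,n-k+1$, $w^j_e=n$ if $e\in E^R$ and $w^j_e=1$ otherwise. If $T^\star_1,T^\star_2,\dots,T^\star_{n-k+1}$ is an optimal solution to $I$, then the restriction of $T^\star_1$ to the vertices in $V$ is a Steiner tree of $G$ (for the terminal set $R$).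
   Context: The sub-tree scheduling for wireless sensor networks with partial coverage (STSWSN-PC): given an undirected graph $G=(V,E)$, a number $s$ of time slots with $1\le s\le |V|$, and edge-weight vectors $w^1,\dots,w^s\in\mathbb{R}^E_+$ (one per time slot), find non-empty, pairwise vertex-disjoint trees $T_1,\dots,T_s$ of $G$ (a single vertex counts as a tree) whose vertex sets cover $V$, minimizing $\sum_{i=1}^s w^i(T_i)$, where $w^i(T_i)$ is the sum of $w^i_e$ over the edges $e$ of $T_i$. Given a graph $G$ and a set $R$ of terminal vertices, a Steiner tree is a subtree $T$ of $G$ with $R\subseteq V(T)$. -}

module Defs where

open import Data.Nat using (ℕ; zero; suc; _≤_; _∸_)
open import Data.Fin using (Fin)
open import Data.Fin.Subset using (Subset; _∈_)
open import Data.Bool using (Bool)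
open import Data.List using (List; []; _∷_; _++_; length; map; allFin; mapMaybe)
open import Data.Nat.ListAction using (sum)
open import Data.List.Relation.Unary.All using (All)
open import Data.List.Relation.Unary.AllPairs using (AllPairs)
open import Data.List.Relation.Unary.Linked using (Linked)
open import Data.List.Relation.Unary.Unique.Propositional using (Unique)
open import Data.Maybe using (Maybe; just; nothing)
open import Data.Product using (Σ; _×_; _,_; proj₁; proj₂; ∃)
open import Data.Sum using (_⊎_; inj₁; inj₂)
open import Data.Empty using (⊥)
open import Relation.Nullary using (¬_)
open import Relation.Binary.PropositionalEquality using (_≡_)
open import Relation.Binary.Construct.Closure.ReflexiveTransitive using (Star)

-- Generic undirected graphs: a vertex type V and an adjacency relation
-- E : V → V → Set (assumed symmetric and loop-free where relevant).
-- A subgraph is given by a vertex predicate U and an edge list F whose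
-- entries (u , v) stand for the unordered edge {u , v}.

SameEdge : {V : Set} → V × V → V × V → Set
SameEdge (a , b) (c , d) = (a ≡ c × b ≡ d) ⊎ (a ≡ d × b ≡ c)

Adj : {V : Set} → List (V × V) → V → V → Set
Adj F u v = Data.List.Membership.Propositional._∈_ (u , v) F ⊎ Data.List.Membership.Propositional._∈_ (v , u) F
  where import Data.List.Membership.Propositional

IsSubgraph : {V : Set} → (V → V → Set) → (V → Set) → List (V × V) → Set
IsSubgraph E U F =
  All (λ e → E (proj₁ e) (proj₂ e) × U (proj₁ e) × U (proj₂ e)) F
  × AllPairs (λ e f → ¬ SameEdge e f) F

Connected : {V : Set} → (V → Set) → List (V × V) → Set
Connected {V} U F = (u v : V) → U u → U v → Star (Adj F) u v

data Cycle {V : Set} (F : List (V × V)) : List V → Set where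
  cycle : (v : V) (vs : List V) → 2 ≤ length vs → Unique (v ∷ vs) →
          Linked (Adj F) (v ∷ vs ++ v ∷ []) → Cycle F (v ∷ vs)

Acyclic : {V : Set} → List (V × V) → Set
Acyclic {V} F = (cs : List V) → ¬ Cycle F cs

IsTree : {V : Set} → (V → V → Set) → (V → Set) → List (V × V) → Set
IsTree {V} E U F = IsSubgraph E U F × (∃ λ (v : V) → U v) × Connected U F × Acyclic F

IsSteinerTree : {V : Set} → (V → V → Set) → (V → Set) → (V → Set) → List (V × V) → Set
IsSteinerTree {V} E R U F = IsTree E U F × ((r : V) → R r → U r)

record Solution {V : Set} (E : V → V → Set) (s : ℕ) : Set₁ where
  field
    vert     : Fin s → V → Set
    edges    : Fin s → List (V × V)
    tree     : (i : Fin s) → IsTree E (vert i) (edges i)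
    disjoint : (i j : Fin s) (v : V) → vert i v → vert j v → i ≡ j
    cover    : (v : V) → ∃ λ (i : Fin s) → vert i v

weight : {V : Set} → (V → V → ℕ) → List (V × V) → ℕ
weight w F = sum (map (λ e → w (proj₁ e) (proj₂ e)) F)

cost : {V : Set} {E : V → V → Set} {s : ℕ} → (Fin s → V → V → ℕ) → Solution E s → ℕ
cost {s = s} w T = sum (map (λ i → weight (w i) (Solution.edges T i)) (allFin s))

Optimal : {V : Set} {E : V → V → Set} {s : ℕ} → (Fin s → V → V → ℕ) → Solution E s → Set₁
Optimal {E = E} {s = s} w T = (T′ : Solution E s) → cost w T ≤ cost w T′

-- fictitious vertices v^r_j : a terminal r ∈ R and an index j < n - k
Fict : (n k : ℕ) → Subset n → Set
Fict n k R = (Σ (Fin n) λ r → r ∈ R) × Fin (n ∸ k)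

V̄ : (n k : ℕ) → Subset n → Set
V̄ n k R = Fin n ⊎ Fict n k R

Ē : {n : ℕ} (k : ℕ) (R : Subset n) → (Fin n → Fin n → Set) → V̄ n k R → V̄ n k R → Set
Ē k R E (inj₁ u) (inj₁ v) = E u v
Ē k R E (inj₁ u) (inj₂ ((r , _) , _)) = u ≡ r
Ē k R E (inj₂ ((r , _) , _)) (inj₁ u) = u ≡ r
Ē k R E (inj₂ _) (inj₂ _) = ⊥

-- weights of the instance I (slot zero is slot 1, slot suc j is slot j+2);
-- only their values on edges of Ē matter
w̄ : (n k : ℕ) (R : Subset n) → Fin (suc (n ∸ k)) → V̄ n k R → V̄ n k R → ℕ
w̄ n k R i (inj₁ _) (inj₁ _) = 1
w̄ n k R Fin.zero _ _ = 0
w̄ n k R (Fin.suc _) _ _ = n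

restrict : (n k : ℕ) (R : Subset n) → List (V̄ n k R × V̄ n k R) → List (Fin n × Fin n)
restrict n k R = mapMaybe f
  where
    f : _ → Maybe _
    f (inj₁ u , inj₁ v) = just (u , v)
    f _ = nothing

-- An optimal solution costs less than n: compare it with the solution that puts a spanning
-- tree of G (at most n - 1 edges of weight 1) into slot 1, with every fictitious vertex of
-- the terminals other than some r₀ hung from its terminal at weight 0, and one fictitious
-- vertex of r₀ alone in each of the other n - k slots. In slots 2, …, n - k + 1 an edge at a
-- fictitious vertex costs n, so there a fictitious vertex is alone in its tree. If a terminal
-- r lay in such a slot, then r, its n - k fictitious vertices and one fictitious vertex of
-- another terminal would be n - k + 2 vertices pairwise in different trees, too many for
-- n - k + 1 slots. Hence T₁ contains every terminal, and since fictitious vertices are leaves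
-- hanging off their terminals, collapsing them shows that T₁ restricted to V is a tree.
module Submission where

open import Defs
open import Data.Nat using (ℕ; suc; _≤_; _∸_)
open import Data.Fin using (Fin)
open import Data.Fin.Subset using (Subset)
open import Data.Product using (_×_)
open import Data.Sum using (inj₁)
open import Relation.Nullary using (¬_)
open import Relation.Binary.Definitions using (DecidableEquality)
open import Relation.Binary.PropositionalEquality using (_≡_)
open import Relation.Binary.Construct.Closure.ReflexiveTransitive using (Star)

module Cycles {V : Set} where

  open import Data.Nat using (s≤s)
  open import Data.List using (List; []; _∷_; _++_; [_])
  open import Data.List.Properties using (++-assoc; length-++-comm)
  open import Data.List.Membership.Propositional using (_∈_)
  open import Data.List.Membership.Propositional.Properties using (∈-∃++)
  open import Data.List.Relation.Unary.Any using (here; there)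
  open import Data.List.Relation.Unary.All as All using (All; []; _∷_)
  import Data.List.Relation.Unary.All.Properties as All
  open import Data.List.Relation.Unary.AllPairs using ([]; _∷_)
  open import Data.List.Relation.Unary.Linked as Linked using (Linked; []; [-]; _∷_)
  import Data.List.Relation.Unary.Unique.Propositional.Properties as Unique
  open import Data.Product using (_,_; proj₁; proj₂; ∃)
  open import Data.Sum using (inj₂; swap)
  open import Data.Empty using (⊥-elim)
  open import Relation.Nullary using (yes; no)
  open import Relation.Binary.PropositionalEquality using (_≢_; refl; sym; trans; cong; subst)

  Linked-mapWithin : ∀ {P : V → Set} {R S : V → V → Set} →
                     (∀ {x y} → P x → P y → R x y → S x y) →
                     ∀ {xs} → All P xs → Linked R xs → Linked S xs
  Linked-mapWithin f _               []      = []
  Linked-mapWithin f _               [-]     = [-]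
  Linked-mapWithin f (px ∷ py ∷ pxs) (r ∷ l) = f px py r ∷ Linked-mapWithin f (py ∷ pxs) l

  Linked-∷ʳ : ∀ {R : V → V → Set} xs {x y} →
              Linked R (xs ++ [ x ]) → R x y → Linked R ((xs ++ [ x ]) ++ [ y ])
  Linked-∷ʳ []           [-]     r = r ∷ [-]
  Linked-∷ʳ (_ ∷ [])     (h ∷ l) r = h ∷ Linked-∷ʳ [] l r
  Linked-∷ʳ (_ ∷ z ∷ zs) (h ∷ l) r = h ∷ Linked-∷ʳ (z ∷ zs) l r

  Linked-into-last : ∀ {R : V → V → Set} {y w} zs →
                     Linked R (y ∷ zs ++ [ w ]) → ∃ λ x → x ∈ y ∷ zs × R x w
  Linked-into-last []       (r ∷ _) = _ , here refl , r
  Linked-into-last (_ ∷ zs) (_ ∷ l) with Linked-into-last zs l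
  ... | x , x∈ , r = x , there x∈ , r

  Acyclic-[] : Acyclic {V} []
  Acyclic-[] _ (cycle _ (_ ∷ _) _ _ (inj₁ () ∷ _))
  Acyclic-[] _ (cycle _ (_ ∷ _) _ _ (inj₂ () ∷ _))

  module _ {F : List (V × V)} where

    Cycle-rotate : ∀ {c b bs} → Cycle F (c ∷ b ∷ bs) → Cycle F (b ∷ bs ++ [ c ])
    Cycle-rotate {c} {b} {bs} (cycle _ _ len (c∉ ∷ uq) (c~b ∷ lk)) =
      cycle b (bs ++ [ c ])
        (subst (2 ≤_) (length-++-comm [ c ] bs) len)
        (Unique.++⁺ uq ([] ∷ []) λ { (x∈ , here refl) → All.lookup c∉ x∈ refl })
        (Linked-∷ʳ (b ∷ bs) lk c~b)

    Cycle-from : ∀ as {c w bs} → Cycle F (c ∷ as ++ w ∷ bs) → ∃ λ ys → Cycle F (w ∷ ys)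
    Cycle-from []       cyc = _ , Cycle-rotate cyc
    Cycle-from (a ∷ as) {c} {w} {bs} cyc =
      Cycle-from as (subst (Cycle F) (cong (a ∷_) (++-assoc as (w ∷ bs) [ c ])) (Cycle-rotate cyc))

    Cycle-through : ∀ {w cs} → w ∈ cs → Cycle F cs → ∃ λ ys → Cycle F (w ∷ ys)
    Cycle-through (here refl) cyc = _ , cyc
    Cycle-through (there w∈)  cyc with ∈-∃++ w∈
    ... | as , _ , refl = Cycle-from as cyc

    -- the two cycle-neighbours of w are distinct, so w cannot have a single neighbour
    pendant-off-cycles : ∀ {w t cs} → (∀ {x} → Adj F w x → x ≡ t) → ¬ Cycle F (w ∷ cs)
    pendant-off-cycles only-t (cycle _ (b ∷ _ ∷ bs) _ (_ ∷ b∉ ∷ _) (w~b ∷ lk))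
      with Linked-into-last bs (Linked.tail lk)
    ... | x , x∈ , x~w = All.lookup b∉ x∈ (trans (only-t w~b) (sym (only-t (swap x~w))))
    pendant-off-cycles _ (cycle _ (_ ∷ []) (s≤s ()) _ _)

  module _ (_≟_ : DecidableEquality V) where

    open import Data.List.Membership.DecPropositional _≟_ using (_∈?_)

    Acyclic-pendant : ∀ {es : List (V × V)} {t w} → Acyclic es → t ≢ w →
                      (∀ {x} → ¬ Adj es w x) → Acyclic ((t , w) ∷ es)
    Acyclic-pendant {es} {t} {w} acyclic t≢w isolated cs cyc with w ∈? cs
    ... | yes w∈ = pendant-off-cycles only-t (proj₂ (Cycle-through w∈ cyc))
      where
        only-t : ∀ {x} → Adj ((t , w) ∷ es) w x → x ≡ t
        only-t (inj₁ (here eq))  = ⊥-elim (t≢w (sym (cong proj₁ eq)))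
        only-t (inj₂ (here eq))  = cong proj₁ eq
        only-t (inj₁ (there e∈)) = ⊥-elim (isolated (inj₁ e∈))
        only-t (inj₂ (there e∈)) = ⊥-elim (isolated (inj₂ e∈))
    Acyclic-pendant {es} {t} {w} acyclic t≢w isolated cs (cycle c cs′ len uq lk) | no w∉ =
      acyclic cs (cycle c cs′ len uq (Linked-mapWithin avoid-w off-w lk))
      where
        avoid-w : ∀ {x y} → x ≢ w → y ≢ w → Adj ((t , w) ∷ es) x y → Adj es x y
        avoid-w _   y≢w (inj₁ (here eq))  = ⊥-elim (y≢w (cong proj₂ eq))
        avoid-w x≢w _   (inj₂ (here eq))  = ⊥-elim (x≢w (cong proj₂ eq))
        avoid-w _   _   (inj₁ (there e∈)) = inj₁ e∈
        avoid-w _   _   (inj₂ (there e∈)) = inj₂ e∈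

        off-cycle : All (_≢ w) (c ∷ cs′)
        off-cycle = All.map (λ w≢x x≡w → w≢x (sym x≡w)) (All.¬Any⇒All¬ _ w∉)

        off-w : All (_≢ w) (c ∷ cs′ ++ [ c ])
        off-w = All.++⁺ off-cycle (All.head off-cycle ∷ [])

module ListTrees {V : Set} (_≟_ : DecidableEquality V) (Ed : V → V → Set) where

  open import Data.Nat using (_+_)
  open import Data.List using (List; []; _∷_; length)
  open import Data.List.Membership.Propositional using (_∈_; _∉_)
  open import Data.List.Membership.DecPropositional _≟_ using (_∈?_)
  open import Data.List.Relation.Binary.Subset.Propositional using (_⊆_)
  open import Data.List.Relation.Unary.Any using (here; there)
  open import Data.List.Relation.Unary.All as All using (All; []; _∷_)
  open import Data.List.Relation.Unary.All.Properties using (¬Any⇒All¬)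
  open import Data.List.Relation.Unary.AllPairs using (AllPairs; []; _∷_)
  open import Data.List.Relation.Unary.Unique.Propositional using (Unique)
  open import Data.Product using (Σ; _,_; proj₁; proj₂; ∃)
  open import Data.Sum using (inj₂)
  open import Relation.Nullary using (yes; no)
  open import Relation.Binary.PropositionalEquality using (refl; sym; trans; cong; subst)
  open import Relation.Binary.Construct.Closure.ReflexiveTransitive as Star using (ε; _◅_; _◅◅_)
  open Cycles

  record ListTree (P : V → Set) : Set where
    field
      vertices        : List V
      edges           : List (V × V)
      edges-inside    : All (λ e → Ed (proj₁ e) (proj₂ e) × proj₁ e ∈ vertices × proj₂ e ∈ vertices) edges
      edges-distinct  : AllPairs (λ e f → ¬ SameEdge e f) edges
      vertices-unique : Unique vertices
      connected       : Connected (_∈ vertices) edges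
      acyclic         : Acyclic edges
      size            : length vertices ≡ suc (length edges)
      vertices-in-P   : All P vertices

  open ListTree public

  isTree : ∀ {P} (g : ListTree P) {v} → v ∈ vertices g → IsTree Ed (_∈ vertices g) (edges g)
  isTree g v∈ = (edges-inside g , edges-distinct g) , (_ , v∈) , connected g , acyclic g

  weaken : ∀ {P Q} → (∀ {v} → P v → Q v) → ListTree P → ListTree Q
  weaken P⇒Q g = record
    { vertices        = vertices g
    ; edges           = edges g
    ; edges-inside    = edges-inside g
    ; edges-distinct  = edges-distinct g
    ; vertices-unique = vertices-unique g
    ; connected       = connected g
    ; acyclic         = acyclic g
    ; size            = size g
    ; vertices-in-P   = All.map P⇒Q (vertices-in-P g)
    }

  singleton : ∀ {P} v → P v → ListTree P
  singleton v pv = record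
    { vertices        = v ∷ []
    ; edges           = []
    ; edges-inside    = []
    ; edges-distinct  = []
    ; vertices-unique = [] ∷ []
    ; connected       = λ { _ _ (here refl) (here refl) → ε }
    ; acyclic         = Acyclic-[]
    ; size            = refl
    ; vertices-in-P   = pv ∷ []
    }

  addLeaf : ∀ {P} (g : ListTree P) {t w} → t ∈ vertices g → w ∉ vertices g → Ed t w → P w → ListTree P
  addLeaf {P} g {t} {w} t∈ w∉ t~w pw = record
    { vertices        = w ∷ vertices g
    ; edges           = (t , w) ∷ edges g
    ; edges-inside    = (t~w , there t∈ , here refl)
                          ∷ All.map (λ (e , u∈ , v∈) → e , there u∈ , there v∈) (edges-inside g)
    ; edges-distinct  = All.map new-edge (edges-inside g) ∷ edges-distinct g
    ; vertices-unique = ¬Any⇒All¬ _ w∉ ∷ vertices-unique g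
    ; connected       = connected′
    ; acyclic         = Acyclic-pendant _≟_ (acyclic g) (λ t≡w → w∉ (subst (_∈ vertices g) t≡w t∈))
                                        isolated
    ; size            = cong suc (size g)
    ; vertices-in-P   = pw ∷ vertices-in-P g
    }
    where
      new-edge : ∀ {e} → Ed (proj₁ e) (proj₂ e) × proj₁ e ∈ vertices g × proj₂ e ∈ vertices g →
                 ¬ SameEdge (t , w) e
      new-edge (_ , _  , v∈) (inj₁ (_ , w≡v)) = w∉ (subst (_∈ vertices g) (sym w≡v) v∈)
      new-edge (_ , u∈ , _)  (inj₂ (_ , w≡u)) = w∉ (subst (_∈ vertices g) (sym w≡u) u∈)

      isolated : ∀ {x} → ¬ Adj (edges g) w x
      isolated (inj₁ e∈) = w∉ (proj₁ (proj₂ (All.lookup (edges-inside g) e∈)))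
      isolated (inj₂ e∈) = w∉ (proj₂ (proj₂ (All.lookup (edges-inside g) e∈)))

      lift : ∀ {a b} → Star (Adj (edges g)) a b → Star (Adj ((t , w) ∷ edges g)) a b
      lift = Star.map λ { (inj₁ e∈) → inj₁ (there e∈) ; (inj₂ e∈) → inj₂ (there e∈) }

      connected′ : Connected (_∈ w ∷ vertices g) ((t , w) ∷ edges g)
      connected′ _ _ (here refl) (here refl) = ε
      connected′ _ v (here refl) (there v∈)  = inj₂ (here refl) ◅ lift (connected g t v t∈ v∈)
      connected′ u _ (there u∈)  (here refl) = lift (connected g u t u∈ t∈) ◅◅ (inj₁ (here refl) ◅ ε)
      connected′ u v (there u∈)  (there v∈)  = lift (connected g u v u∈ v∈)

  absorbWalk : ∀ {P} (g : ListTree P) {x y} → x ∈ vertices g → Star (λ a b → Ed a b × P b) x y →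
               Σ (ListTree P) λ g′ → vertices g ⊆ vertices g′ × y ∈ vertices g′
  absorbWalk g x∈ ε = g , (λ v∈ → v∈) , x∈
  absorbWalk g x∈ (_◅_ {j = b} (x~b , pb) walk) with b ∈? vertices g
  ... | yes b∈ = absorbWalk g b∈ walk
  ... | no b∉ with absorbWalk (addLeaf g x∈ b∉ x~b pb) (here refl) walk
  ...   | g′ , g⊆g′ , y∈ = g′ , (λ v∈ → g⊆g′ (there v∈)) , y∈

  attachAll : ∀ {P} (wt : V → V → ℕ) (g : ListTree P) (xs : List V) →
              (∀ {x} → x ∈ xs → ∃ λ t → t ∈ vertices g × Ed t x × P x × wt t x ≡ 0) →
              Σ (ListTree P) λ g′ → vertices g ⊆ vertices g′ × xs ⊆ vertices g′ ×
                                    weight wt (edges g′) ≡ weight wt (edges g)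
  attachAll wt g []       _      = g , (λ v∈ → v∈) , (λ ()) , refl
  attachAll wt g (x ∷ xs) anchor with attachAll wt g xs (λ x∈ → anchor (there x∈))
  ... | g′ , g⊆g′ , xs⊆g′ , same-weight with x ∈? vertices g′
  ...   | yes x∈ = g′ , g⊆g′ , (λ { (here refl) → x∈ ; (there v∈) → xs⊆g′ v∈ }) , same-weight
  ...   | no x∉ with anchor (here refl)
  ...     | t , t∈ , t~x , px , zero-weight =
    addLeaf g′ (g⊆g′ t∈) x∉ t~x px ,
    (λ v∈ → there (g⊆g′ v∈)) ,
    (λ { (here refl) → here refl ; (there v∈) → there (xs⊆g′ v∈) }) ,
    trans (cong (_+ weight wt (edges g′)) zero-weight) same-weight

module Restriction {n : ℕ} (k : ℕ) (R : Subset n) (E : Fin n → Fin n → Set) where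

  open import Data.List using (List; []; _∷_; [_]; map)
  open import Data.List.Properties using (length-map; map-++)
  open import Data.List.Membership.Propositional using (_∈_)
  open import Data.List.Relation.Unary.Any using (here; there)
  open import Data.List.Relation.Unary.All as All using (All; []; _∷_)
  open import Data.List.Relation.Unary.AllPairs using (AllPairs; []; _∷_)
  open import Data.List.Relation.Unary.Linked as Linked using (Linked)
  import Data.List.Relation.Unary.Linked.Properties as Linked
  import Data.List.Relation.Unary.Unique.Propositional.Properties as Unique
  open import Data.Product using (_,_; proj₁; proj₂; ∃)
  open import Data.Sum as Sum using (_⊎_; inj₂; swap)
  open import Data.Sum.Properties using (inj₁-injective)
  open import Data.Empty using (⊥-elim)
  open import Relation.Binary.PropositionalEquality using (refl; sym; cong; subst)
  open import Relation.Binary.Construct.Closure.ReflexiveTransitive using (ε; _◅_)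

  private
    V : Set
    V = V̄ n k R

    restrictᴿ : List (V × V) → List (Fin n × Fin n)
    restrictᴿ = restrict n k R

    ĒEdges : List (V × V) → Set
    ĒEdges = All (λ e → Ē k R E (proj₁ e) (proj₂ e))

  restrict-∈⁻ : ∀ {u v} F → (u , v) ∈ restrictᴿ F → (inj₁ u , inj₁ v) ∈ F
  restrict-∈⁻ ((inj₁ _ , inj₁ _) ∷ F) (here refl) = here refl
  restrict-∈⁻ ((inj₁ _ , inj₁ _) ∷ F) (there e∈)  = there (restrict-∈⁻ F e∈)
  restrict-∈⁻ ((inj₁ _ , inj₂ _) ∷ F) e∈          = there (restrict-∈⁻ F e∈)
  restrict-∈⁻ ((inj₂ _ , _)      ∷ F) e∈          = there (restrict-∈⁻ F e∈)

  restrict-∈⁺ : ∀ {u v} F → (inj₁ u , inj₁ v) ∈ F → (u , v) ∈ restrictᴿ F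
  restrict-∈⁺ ((inj₁ _ , inj₁ _) ∷ F) (here refl) = here refl
  restrict-∈⁺ ((inj₁ _ , inj₁ _) ∷ F) (there e∈)  = there (restrict-∈⁺ F e∈)
  restrict-∈⁺ ((inj₁ _ , inj₂ _) ∷ F) (there e∈)  = restrict-∈⁺ F e∈
  restrict-∈⁺ ((inj₂ _ , _)      ∷ F) (there e∈)  = restrict-∈⁺ F e∈

  restrict-All : ∀ {P : V × V → Set} F → All P F →
                 All (λ e → P (inj₁ (proj₁ e) , inj₁ (proj₂ e))) (restrictᴿ F)
  restrict-All []                      []       = []
  restrict-All ((inj₁ _ , inj₁ _) ∷ F) (p ∷ ps) = p ∷ restrict-All F ps
  restrict-All ((inj₁ _ , inj₂ _) ∷ F) (_ ∷ ps) = restrict-All F ps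
  restrict-All ((inj₂ _ , _)      ∷ F) (_ ∷ ps) = restrict-All F ps

  SameEdge-inj₁ : ∀ {a b c d : Fin n} → SameEdge (a , b) (c , d) →
                  SameEdge {V} (inj₁ a , inj₁ b) (inj₁ c , inj₁ d)
  SameEdge-inj₁ (inj₁ (refl , refl)) = inj₁ (refl , refl)
  SameEdge-inj₁ (inj₂ (refl , refl)) = inj₂ (refl , refl)

  restrict-distinct : ∀ F → AllPairs (λ e f → ¬ SameEdge e f) F →
                      AllPairs (λ e f → ¬ SameEdge e f) (restrictᴿ F)
  restrict-distinct []                      []       = []
  restrict-distinct ((inj₁ _ , inj₁ _) ∷ F) (p ∷ ps) =
    All.map (λ ¬same same → ¬same (SameEdge-inj₁ same)) (restrict-All F p) ∷ restrict-distinct F ps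
  restrict-distinct ((inj₁ _ , inj₂ _) ∷ F) (_ ∷ ps) = restrict-distinct F ps
  restrict-distinct ((inj₂ _ , _)      ∷ F) (_ ∷ ps) = restrict-distinct F ps

  collapse : V → Fin n
  collapse (inj₁ u)             = u
  collapse (inj₂ ((r , _) , _)) = r

  edge-collapse : ∀ {F} → ĒEdges F → ∀ {x y} → (x , y) ∈ F →
                  collapse x ≡ collapse y ⊎ Adj (restrictᴿ F) (collapse x) (collapse y)
  edge-collapse {F} _    {inj₁ _} {inj₁ _} e∈ = inj₂ (inj₁ (restrict-∈⁺ F e∈))
  edge-collapse     in-Ē {inj₁ _} {inj₂ _} e∈ = inj₁ (All.lookup in-Ē e∈)
  edge-collapse     in-Ē {inj₂ _} {inj₁ _} e∈ = inj₁ (sym (All.lookup in-Ē e∈))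
  edge-collapse     in-Ē {inj₂ _} {inj₂ _} e∈ = ⊥-elim (All.lookup in-Ē e∈)

  Adj-collapse : ∀ {F} → ĒEdges F → ∀ {x y} → Adj F x y →
                 collapse x ≡ collapse y ⊎ Adj (restrictᴿ F) (collapse x) (collapse y)
  Adj-collapse in-Ē (inj₁ e∈) = edge-collapse in-Ē e∈
  Adj-collapse in-Ē (inj₂ e∈) = Sum.map sym swap (edge-collapse in-Ē e∈)

  Star-collapse : ∀ {F} → ĒEdges F → ∀ {x y} →
                  Star (Adj F) x y → Star (Adj (restrictᴿ F)) (collapse x) (collapse y)
  Star-collapse in-Ē ε = ε
  Star-collapse in-Ē (x~y ◅ walk) with Adj-collapse in-Ē x~y
  ... | inj₁ same rewrite same = Star-collapse in-Ē walk
  ... | inj₂ adj  = adj ◅ Star-collapse in-Ē walk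

  Acyclic-restrict : ∀ F → Acyclic F → Acyclic (restrictᴿ F)
  Acyclic-restrict F acyclic _ (cycle v vs len uq lk) =
    acyclic (map inj₁ (v ∷ vs))
      (cycle (inj₁ v) (map inj₁ vs)
        (subst (2 ≤_) (sym (length-map inj₁ vs)) len)
        (Unique.map⁺ inj₁-injective uq)
        (subst (Linked (Adj F)) (cong (inj₁ v ∷_) (map-++ inj₁ vs [ v ]))
          (Linked.map⁺ (Linked.map (Sum.map (restrict-∈⁻ F) (restrict-∈⁻ F)) lk))))

  IsTree-restrict : ∀ {U F} → IsTree (Ē k R E) U F → ∃ (λ r → U (inj₁ r)) →
                    IsTree E (λ v → U (inj₁ v)) (restrictᴿ F)
  IsTree-restrict {F = F} ((inside , distinct) , _ , connected , acyclic) nonempty =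
    (restrict-All F inside , restrict-distinct F distinct) ,
    nonempty ,
    (λ u v u∈ v∈ → Star-collapse (All.map proj₁ inside) (connected (inj₁ u) (inj₁ v) u∈ v∈)) ,
    Acyclic-restrict F acyclic

module Counting where

  open import Data.Nat using (zero; _<_; s≤s)
  open import Data.Nat.Properties using (≤-trans; m≤m+n; m≤n+m)
  open import Data.Nat.ListAction using (sum)
  open import Data.Fin as Fin using (suc)
  import Data.Fin.Properties as Fin
  open import Data.Fin.Subset using (_∈_; ∣_∣; ⁅_⁆; Nonempty; _⊆_)
  open import Data.Fin.Subset.Properties
    using (_∈?_; nonempty?; Empty-unique; ∣⊥∣≡0; x∈⁅x⁆; ∣⁅x⁆∣≡1; p⊆q⇒∣p∣≤∣q∣)
  open import Data.List using (List; _∷_; length; lookup; tabulate)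
  open import Data.List.Membership.Propositional.Properties using (∈-lookup)
  import Data.List.Membership.Propositional as List
  open import Data.List.Relation.Unary.Any using (here; there)
  import Data.List.Relation.Unary.All as All
  open import Data.List.Relation.Unary.AllPairs using (_∷_)
  open import Data.List.Relation.Unary.Unique.Propositional using (Unique)
  open import Data.Product using (_,_; ∃)
  open import Data.Empty using (⊥-elim)
  open import Relation.Nullary using (yes; no; contradiction)
  open import Relation.Nullary.Decidable using (_×-dec_; ¬?)
  open import Relation.Binary.PropositionalEquality using (_≢_; refl; sym; cong; subst)

  ∈⇒≤sum : ∀ {m ms} → m List.∈ ms → m ≤ sum ms
  ∈⇒≤sum {ms = m ∷ ms} (here refl) = m≤m+n m (sum ms)
  ∈⇒≤sum {ms = m ∷ ms} (there m∈)  = ≤-trans (∈⇒≤sum m∈) (m≤n+m (sum ms) m)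

  sum-zeros : ∀ N → sum (tabulate {n = N} λ _ → 0) ≡ 0
  sum-zeros zero    = refl
  sum-zeros (suc N) = sum-zeros N

  Unique-lookup-injective : ∀ {A : Set} {xs : List A} → Unique xs →
                            ∀ {i j} → lookup xs i ≡ lookup xs j → i ≡ j
  Unique-lookup-injective (_  ∷ _)  {Fin.zero} {Fin.zero} _  = refl
  Unique-lookup-injective (x∉ ∷ _)  {Fin.zero} {suc j}    eq = ⊥-elim (All.lookup x∉ (∈-lookup j) eq)
  Unique-lookup-injective (x∉ ∷ _)  {suc i}    {Fin.zero} eq = ⊥-elim (All.lookup x∉ (∈-lookup i) (sym eq))
  Unique-lookup-injective (_  ∷ uq) {suc i}    {suc j}    eq = cong suc (Unique-lookup-injective uq eq)

  Unique⇒length≤ : ∀ {n} {us : List (Fin n)} → Unique us → length us ≤ n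
  Unique⇒length≤ uq = Fin.injective⇒≤ (Unique-lookup-injective uq)

  module _ {n} (p : Subset n) where

    0<∣p∣⇒Nonempty : 0 < ∣ p ∣ → Nonempty p
    0<∣p∣⇒Nonempty 0<∣p∣ with nonempty? p
    ... | yes ne    = ne
    ... | no  empty = contradiction (subst (0 <_) (∣⊥∣≡0 n) 0<∣⊥∣) λ ()
      where
        0<∣⊥∣ : 0 < ∣ Data.Fin.Subset.⊥ {n} ∣
        0<∣⊥∣ = subst (λ q → 0 < ∣ q ∣) (Empty-unique empty) 0<∣p∣

    1<∣p∣⇒∃∈≢ : 1 < ∣ p ∣ → ∀ x → ∃ λ y → y ∈ p × y ≢ x
    1<∣p∣⇒∃∈≢ 1<∣p∣ x with Fin.any? (λ y → (y ∈? p) ×-dec ¬? (y Fin.≟ x))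
    ... | yes y∈≢ = y∈≢
    ... | no  none = contradiction (subst (1 <_) (∣⁅x⁆∣≡1 x) 1<∣⁅x⁆∣) λ { (s≤s ()) }
      where
        p⊆⁅x⁆ : p ⊆ ⁅ x ⁆
        p⊆⁅x⁆ {y} y∈ with y Fin.≟ x
        ... | yes refl = x∈⁅x⁆ x
        ... | no  y≢x  = ⊥-elim (none (y , y∈ , y≢x))

        1<∣⁅x⁆∣ : 1 < ∣ ⁅ x ⁆ ∣
        1<∣⁅x⁆∣ = ≤-trans 1<∣p∣ (p⊆q⇒∣p∣≤∣q∣ p⊆⁅x⁆)

module Instance {n : ℕ} (k : ℕ) (R : Subset n) (E : Fin n → Fin n → Set) where

  open import Data.Nat using (_+_; _<_; z≤n; s≤s)
  open import Data.Nat.Properties using (≤-trans; <⇒≱; n<1+n; m≤n+m; +-identityʳ; module ≤-Reasoning)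
  open import Data.Nat.ListAction using (sum)
  open import Data.Fin as Fin using (zero; suc)
  import Data.Fin.Properties as Fin
  open import Data.Fin.Subset using (∣_∣; Nonempty)
  import Data.Fin.Subset as Subset
  open import Data.Fin.Subset.Properties using (_∈?_)
  open import Data.Vec.Properties.WithK using ([]=-irrelevant)
  open import Data.List using (List; []; _∷_; length; map; allFin; tabulate; concatMap)
  open import Data.List.Properties using (length-map; map-tabulate)
  open import Data.List.Membership.Propositional using (_∈_; _∉_)
  open import Data.List.Relation.Binary.Subset.Propositional using (_⊆_)
  open import Data.List.Membership.Propositional.Properties
    using (∈-map⁺; ∈-map⁻; ∈-allFin; ∈-concatMap⁺; ∈-concatMap⁻)
  open import Data.List.Relation.Unary.Any as Any using (here)
  open import Data.List.Relation.Unary.All as All using (All; []; _∷_)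
  open import Data.List.Relation.Unary.AllPairs using ([])
  open import Data.List.Relation.Unary.Unique.Propositional using (Unique)
  import Data.List.Relation.Unary.Unique.Propositional.Properties as Unique
  open import Data.Product using (Σ; _,_; proj₁; proj₂; ∃; ∃₂)
  import Data.Product.Properties as Product
  open import Data.Sum using (inj₂)
  import Data.Sum.Properties as Sum
  open import Data.Unit using (⊤; tt)
  open import Data.Empty using (⊥; ⊥-elim)
  open import Function using (_∘_)
  open import Relation.Nullary using (yes; no)
  open import Relation.Binary.PropositionalEquality using (_≢_; refl; sym; trans; cong; subst)
  open import Relation.Binary.Construct.Closure.ReflexiveTransitive as Star using (ε; _◅_)
  open Counting
  open Restriction k R E using (collapse)

  N : ℕ
  N = n ∸ k

  V : Set
  V = V̄ n k R

  Ē′ : V → V → Set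
  Ē′ = Ē k R E

  w : Fin (suc N) → V → V → ℕ
  w = w̄ n k R

  fict : (r : Fin n) → r Subset.∈ R → Fin N → V
  fict r r∈R m = inj₂ ((r , r∈R) , m)

  fict-index-injective : ∀ {r r∈R m m′} → fict r r∈R m ≡ fict r r∈R m′ → m ≡ m′
  fict-index-injective refl = refl

  _≟_ : DecidableEquality V
  _≟_ = Sum.≡-dec Fin._≟_ (Product.≡-dec (Product.≡-dec Fin._≟_ λ p q → yes ([]=-irrelevant p q))
                                         Fin._≟_)

  module LowerBound (T : Solution Ē′ (suc N)) where
    open Solution T

    edge-inside : ∀ i {a b} → (a , b) ∈ edges i → Ē′ a b × vert i a × vert i b
    edge-inside i = All.lookup (proj₁ (proj₁ (tree i)))

    edge-weight≤cost : ∀ i {a b} → (a , b) ∈ edges i → w i a b ≤ cost w T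
    edge-weight≤cost i e∈ =
      ≤-trans (∈⇒≤sum (∈-map⁺ (λ e → w i (proj₁ e) (proj₂ e)) e∈))
              (∈⇒≤sum (∈-map⁺ (λ i → weight (w i) (edges i)) (∈-allFin i)))

    incident-edge : ∀ i {x y} → vert i x → vert i y → x ≢ y → ∃ λ z → Adj (edges i) x z
    incident-edge i {x} {y} x∈ y∈ x≢y with proj₁ (proj₂ (proj₂ (tree i))) x y x∈ y∈
    ... | ε       = ⊥-elim (x≢y refl)
    ... | x~z ◅ _ = _ , x~z

    terminal-of-fict : ∀ i {r r∈R m y} → vert i (fict r r∈R m) → vert i y → fict r r∈R m ≢ y →
                       vert i (inj₁ r)
    terminal-of-fict i x∈ y∈ x≢y with incident-edge i x∈ y∈ x≢y
    ... | inj₁ _ , inj₁ e∈ with edge-inside i e∈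
    ...   | refl , _ , u∈ = u∈
    terminal-of-fict i x∈ y∈ x≢y | inj₁ _ , inj₂ e∈ with edge-inside i e∈
    ...   | refl , u∈ , _ = u∈
    terminal-of-fict i x∈ y∈ x≢y | inj₂ _ , inj₁ e∈ with edge-inside i e∈
    ...   | () , _
    terminal-of-fict i x∈ y∈ x≢y | inj₂ _ , inj₂ e∈ with edge-inside i e∈
    ...   | () , _

    shared-fict-costs-n : ∀ j {x y} → vert (suc j) (inj₂ x) → vert (suc j) y → inj₂ x ≢ y →
                          n ≤ cost w T
    shared-fict-costs-n j x∈ y∈ x≢y with incident-edge (suc j) x∈ y∈ x≢y
    ... | _      , inj₁ e∈ = edge-weight≤cost (suc j) e∈
    ... | inj₁ _ , inj₂ e∈ = edge-weight≤cost (suc j) e∈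
    ... | inj₂ _ , inj₂ e∈ = edge-weight≤cost (suc j) e∈

    terminal-not-later : 2 ≤ ∣ R ∣ → Fin N → cost w T < n →
                         ∀ {r j} → r Subset.∈ R → ¬ vert (suc j) (inj₁ r)
    terminal-not-later 2≤∣R∣ m₀ cheap {r} {j} r∈R r∈j =
      clash (Fin.pigeonhole (n<1+n (suc N)) (slot ∘ item))
      where
        other : ∃ λ r′ → r′ Subset.∈ R × r′ ≢ r
        other = 1<∣p∣⇒∃∈≢ R 2≤∣R∣ r

        -- N + 2 vertices, no two of which may share a tree
        item : Fin (suc (suc N)) → V
        item zero          = inj₁ r
        item (suc zero)    = fict (proj₁ other) (proj₁ (proj₂ other)) m₀
        item (suc (suc m)) = fict r r∈R m

        slot : V → Fin (suc N)
        slot x = proj₁ (cover x)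

        in-slot : ∀ x → vert (slot x) x
        in-slot x = proj₂ (cover x)

        r-slot : ∀ {i} → vert i (inj₁ r) → i ≡ suc j
        r-slot r∈i = disjoint _ _ _ r∈i r∈j

        r-alone : ∀ {i x} → vert i (inj₁ r) → ¬ vert i (inj₂ x)
        r-alone r∈i x∈i with r-slot r∈i
        ... | refl = <⇒≱ cheap (shared-fict-costs-n j x∈i r∈i λ ())

        fict-alone : ∀ {i m y} → vert i (fict r r∈R m) → vert i y → fict r r∈R m ≢ y → ⊥
        fict-alone x∈i y∈i x≢y with r-slot (terminal-of-fict _ x∈i y∈i x≢y)
        ... | refl = <⇒≱ cheap (shared-fict-costs-n j x∈i y∈i x≢y)

        together : ∀ a b → slot (item a) ≡ slot (item b) → vert (slot (item a)) (item b)
        together a b same = subst (λ i → vert i (item b)) (sym same) (in-slot (item b))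

        clash : (∃₂ λ a b → a Fin.< b × slot (item a) ≡ slot (item b)) → ⊥
        clash (a@zero , b@(suc zero) , _ , same) = r-alone (in-slot (item a)) (together a b same)
        clash (a@zero , b@(suc (suc _)) , _ , same) = r-alone (in-slot (item a)) (together a b same)
        clash (a@(suc zero) , b@(suc (suc _)) , _ , same) =
          fict-alone (together a b same) (in-slot (item a)) (proj₂ (proj₂ other) ∘ sym ∘ cong collapse)
        clash (suc zero , suc zero , s≤s () , _)
        clash (a@(suc (suc _)) , b@(suc (suc _)) , s≤s (s≤s m<m′) , same) =
          fict-alone (in-slot (item a)) (together a b same) (Fin.<⇒≢ m<m′ ∘ fict-index-injective)

    terminal-in-first-slot : 2 ≤ ∣ R ∣ → Fin N → cost w T < n →
                             ∀ {r} → r Subset.∈ R → vert zero (inj₁ r)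
    terminal-in-first-slot 2≤∣R∣ m₀ cheap {r} r∈R with cover (inj₁ r)
    ... | zero  , r∈ = r∈
    ... | suc _ , r∈ = ⊥-elim (terminal-not-later 2≤∣R∣ m₀ cheap r∈R r∈)

  IsReal : V → Set
  IsReal x = ∃ λ u → x ≡ inj₁ u

  Unique-real⇒length≤ : ∀ {xs} → All IsReal xs → Unique xs → length xs ≤ n
  Unique-real⇒length≤ {xs} real uq =
    subst (_≤ n) (length-map collapse xs) (Unique⇒length≤ (Unique.map⁻ (subst Unique (as-map real) uq)))
    where
      as-map : ∀ {xs} → All IsReal xs → xs ≡ map inj₁ (map collapse xs)
      as-map []                  = refl
      as-map ((u , refl) ∷ real) = cong (inj₁ u ∷_) (as-map real)

  weight₀≤length : ∀ F → weight (w zero) F ≤ length F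
  weight₀≤length []                      = z≤n
  weight₀≤length ((inj₁ _ , inj₁ _) ∷ F) = s≤s (weight₀≤length F)
  weight₀≤length ((inj₁ _ , inj₂ _) ∷ F) = ≤-trans (weight₀≤length F) (m≤n+m _ 1)
  weight₀≤length ((inj₂ _ , _)      ∷ F) = ≤-trans (weight₀≤length F) (m≤n+m _ 1)

  module CheapSolution (G-connected : ∀ u v → Star E u v) {r₀} (r₀∈R : r₀ Subset.∈ R) where
    open ListTrees _≟_ Ē′
    open Cycles using (Acyclic-[])

    real-walk : ∀ u v → Star (λ a b → Ē′ a b × IsReal b) (inj₁ u) (inj₁ v)
    real-walk u v = Star.gmap inj₁ (λ e → e , _ , refl) (G-connected u v)

    spanning : ∀ us → Σ (ListTree IsReal) λ g →
                 inj₁ r₀ ∈ vertices g × All (λ u → inj₁ u ∈ vertices g) us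
    spanning []       = singleton (inj₁ r₀) (r₀ , refl) , here refl , []
    spanning (u ∷ us) with spanning us
    ... | g , r₀∈g , us∈g with absorbWalk g r₀∈g (real-walk r₀ u)
    ...   | g′ , g⊆g′ , u∈g′ = g′ , g⊆g′ r₀∈g , u∈g′ ∷ All.map g⊆g′ us∈g

    G-tree : ListTree IsReal
    G-tree = proj₁ (spanning (allFin n))

    G-tree-spans : ∀ u → inj₁ u ∈ vertices G-tree
    G-tree-spans u = All.lookup (proj₂ (proj₂ (spanning (allFin n)))) (∈-allFin u)

    G-tree-cheap : weight (w zero) (edges G-tree) < n
    G-tree-cheap =
      ≤-trans (s≤s (weight₀≤length (edges G-tree)))
              (subst (_≤ n) (size G-tree) (Unique-real⇒length≤ (vertices-in-P G-tree) (vertices-unique G-tree)))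

    -- the fictitious vertices of r₀ are kept back to fill the slots 2, …, n - k + 1
    Unreserved : V → Set
    Unreserved (inj₁ _)             = ⊤
    Unreserved (inj₂ ((r , _) , _)) = r ≢ r₀

    unreservedFictsOf : Fin n → List V
    unreservedFictsOf r with r ∈? R | r Fin.≟ r₀
    ... | yes r∈R | no _ = map (fict r r∈R) (allFin N)
    ... | _       | _    = []

    unreservedFicts : List V
    unreservedFicts = concatMap unreservedFictsOf (allFin n)

    ∈-unreservedFicts : ∀ {r} (r∈R : r Subset.∈ R) m → r ≢ r₀ → fict r r∈R m ∈ unreservedFicts
    ∈-unreservedFicts {r} r∈R m r≢r₀ =
      ∈-concatMap⁺ unreservedFictsOf (Any.map (λ { refl → ∈-of-r }) (∈-allFin r))
      where
        ∈-of-r : fict r r∈R m ∈ unreservedFictsOf r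
        ∈-of-r with r ∈? R | r Fin.≟ r₀
        ... | yes r∈R′ | no _     rewrite []=-irrelevant r∈R r∈R′ = ∈-map⁺ (fict r r∈R′) (∈-allFin m)
        ... | no r∉R   | _        = ⊥-elim (r∉R r∈R)
        ... | yes _    | yes r≡r₀ = ⊥-elim (r≢r₀ r≡r₀)

    G-tree′ : ListTree Unreserved
    G-tree′ = weaken (λ { (_ , refl) → tt }) G-tree

    Anchored : V → Set
    Anchored x = ∃ λ t → t ∈ vertices G-tree′ × Ē′ t x × Unreserved x × w zero t x ≡ 0

    anchored : ∀ {x} → x ∈ unreservedFicts → Anchored x
    anchored x∈ with Any.satisfied (∈-concatMap⁻ unreservedFictsOf {xs = allFin n} x∈)
    ... | r , x∈r = anchored-at r x∈r
      where
        anchored-at : ∀ r {x} → x ∈ unreservedFictsOf r → Anchored x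
        anchored-at r x∈ with r ∈? R | r Fin.≟ r₀
        anchored-at r x∈ | yes r∈R | no r≢r₀ with ∈-map⁻ (fict r r∈R) x∈
        ... | _ , _ , refl = inj₁ r , G-tree-spans r , refl , r≢r₀ , refl
        anchored-at r () | yes _ | yes _
        anchored-at r () | no _  | _

    attached : Σ (ListTree Unreserved) λ g →
                 vertices G-tree′ ⊆ vertices g × unreservedFicts ⊆ vertices g ×
                 weight (w zero) (edges g) ≡ weight (w zero) (edges G-tree′)
    attached = attachAll (w zero) G-tree′ unreservedFicts anchored

    first-tree : ListTree Unreserved
    first-tree = proj₁ attached

    ∈-first-tree : ∀ {x} → Unreserved x → x ∈ vertices first-tree
    ∈-first-tree {inj₁ u}               _    = proj₁ (proj₂ attached) (G-tree-spans u)
    ∈-first-tree {inj₂ ((r , r∈R) , m)} r≢r₀ =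
      proj₁ (proj₂ (proj₂ attached)) (∈-unreservedFicts r∈R m r≢r₀)

    reserved : Fin N → V
    reserved = fict r₀ r₀∈R

    reserved∉first-tree : ∀ {m} → reserved m ∉ vertices first-tree
    reserved∉first-tree m∈ = All.lookup (vertices-in-P first-tree) m∈ refl

    vert′ : Fin (suc N) → V → Set
    vert′ zero    x = x ∈ vertices first-tree
    vert′ (suc m) x = x ≡ reserved m

    edges′ : Fin (suc N) → List (V × V)
    edges′ zero    = edges first-tree
    edges′ (suc m) = []

    tree′ : ∀ i → IsTree Ē′ (vert′ i) (edges′ i)
    tree′ zero    = isTree first-tree (∈-first-tree {inj₁ r₀} tt)
    tree′ (suc m) = ([] , []) , (reserved m , refl) , (λ { _ _ refl refl → ε }) , Acyclic-[]

    disjoint′ : ∀ i j x → vert′ i x → vert′ j x → i ≡ j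
    disjoint′ zero    zero    _ _    _    = refl
    disjoint′ zero    (suc _) _ x∈   refl = ⊥-elim (reserved∉first-tree x∈)
    disjoint′ (suc _) zero    _ refl x∈   = ⊥-elim (reserved∉first-tree x∈)
    disjoint′ (suc _) (suc _) _ refl eq   = cong suc (fict-index-injective eq)

    cover′ : ∀ x → ∃ λ i → vert′ i x
    cover′ (inj₁ u) = zero , ∈-first-tree tt
    cover′ (inj₂ ((r , r∈R) , m)) with r Fin.≟ r₀
    ... | yes refl = suc m , cong (λ r∈ → fict r₀ r∈ m) ([]=-irrelevant r∈R r₀∈R)
    ... | no r≢r₀  = zero , ∈-first-tree r≢r₀

    solution : Solution Ē′ (suc N)
    solution = record
      { vert = vert′ ; edges = edges′ ; tree = tree′ ; disjoint = disjoint′ ; cover = cover′ }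

    cost<n : cost w solution < n
    cost<n = begin-strict
      cost w solution                         ≡⟨ cong (weight (w zero) (edges first-tree) +_)
                                                      later-slots-free ⟩
      weight (w zero) (edges first-tree) + 0  ≡⟨ +-identityʳ _ ⟩
      weight (w zero) (edges first-tree)      ≡⟨ proj₂ (proj₂ (proj₂ attached)) ⟩
      weight (w zero) (edges G-tree)          <⟨ G-tree-cheap ⟩
      n                                       ∎
      where
        open ≤-Reasoning
        later-slots-free : sum (map (λ i → weight (w i) (edges′ i)) (tabulate Fin.suc)) ≡ 0
        later-slots-free = trans (cong sum (map-tabulate {n = N} Fin.suc _)) (sum-zeros N)

  cheap-solution : (∀ u v → Star E u v) → Nonempty R → ∃ λ (T : Solution Ē′ (suc N)) → cost w T < n
  cheap-solution G-connected (_ , r₀∈R) = solution , cost<n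
    where open CheapSolution G-connected r₀∈R

open import Data.Nat using (_<_; z≤n; s≤s)
open import Data.Nat.Properties using (≤-trans; ≤-<-trans; ∸-monoʳ-<; m<n⇒0<n∸m)
open import Data.Fin using (zero; fromℕ<)
open import Data.Fin.Subset using (_∈_; ∣_∣; Nonempty)
open import Data.Fin.Subset.Properties using (∣p∣≤n)
open import Data.Product using (_,_; map₂)
open Restriction using (IsTree-restrict)
open Counting using (0<∣p∣⇒Nonempty)

lemma1 : (n : ℕ) (E : Fin n → Fin n → Set)
           → (∀ u v → E u v → E v u)
           → (∀ v → ¬ E v v)
           → (∀ u v → Star E u v)
           → (R : Subset n) → 4 ≤ ∣ R ∣
           → (k : ℕ) → ∣ R ∣ ∸ 1 ≤ k → k ≤ n ∸ 2
           → (T : Solution (Ē k R E) (suc (n ∸ k)))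
           → Optimal (w̄ n k R) T
           → IsSteinerTree E (λ v → v ∈ R)
               (λ v → Solution.vert T zero (inj₁ v))
               (restrict n k R (Solution.edges T zero))
lemma1 n E _ _ G-connected R 4≤∣R∣ k _ k≤n∸2 T optimal =
  IsTree-restrict k R E (Solution.tree T zero) (map₂ in-first-slot R-nonempty) , λ _ → in-first-slot
  where
    open Instance k R E

    2≤∣R∣ : 2 ≤ ∣ R ∣
    2≤∣R∣ = ≤-trans (s≤s (s≤s z≤n)) 4≤∣R∣

    R-nonempty : Nonempty R
    R-nonempty = 0<∣p∣⇒Nonempty R (≤-trans (s≤s z≤n) 2≤∣R∣)

    k<n : k < n
    k<n = ≤-<-trans k≤n∸2 (∸-monoʳ-< (s≤s z≤n) (≤-trans 2≤∣R∣ (∣p∣≤n R)))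

    m₀ : Fin (n ∸ k)
    m₀ = fromℕ< (m<n⇒0<n∸m k<n)

    T-cheap : cost (w̄ n k R) T < n
    T-cheap with cheap-solution G-connected R-nonempty
    ... | T′ , T′-cheap = ≤-<-trans (optimal T′) T′-cheap

    in-first-slot : ∀ {r} → r ∈ R → Solution.vert T zero (inj₁ r)
    in-first-slot = LowerBound.terminal-in-first-slot T 2≤∣R∣ m₀ T-cheap
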